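{- Let $\Phi$ be a second-order constraint problem with a model $(\mathcal J,\kappa)$. Then there exists a second-order index substitution $\kappa_r$ such that $(\mathcal J,\kappa_r)$ is a model of $\Phi$ and $\mathrm{Var}(\kappa_r(\alpha))\subseteq\mathrm{SV}(\alpha)$ for each second-order variable $\alpha$ of $\Phi$.
   Context: Index terms are built from index variables $i$ and index symbols $g$ (with arities, including $0$, unary $\mathsf s$, binary $+$); an interpretation $\mathcal J$ maps each $k$-ary index symbol to a total weakly monotone function $\mathbb N^k\to\mathbb N$ ($0,\mathsf s,+$ standard), and for first-order index terms $a\le_{\mathcal J}b$ means that the value of $a$ is at most that of $b$ under every assignment of naturals to index variables. Let $\mathcal S$ be a countably infinite set of second-order index variables $\alpha,\beta,\dots$; second-order index terms are $\mathfrak a ::= i\mid\alpha\mid g(\mathfrak a_1,\dots,\mathfrak a_k)$; $\mathrm{Var}(\mathfrak a)$ denotes its (ordinary) index variables. A second-order constraint problem (SOCP) $\Phi$ is a set of inequality constraints $\mathfrak a\le\mathfrak b$ and occurrence constraints $i\not\leadsto\alpha$. A pair $(\mathcal J,\kappa)$, where $\kappa$ maps second-order variables to index terms without second-order variables, is a model of $\Phi$ if $\mathfrak a\kappa\le_{\mathcal J}\mathfrak b\kappa$ for all $(\mathfrak a\le\mathfrak b)\in\Phi$ and $i\notin\mathrm{Var}(\kappa(\alpha))$ for all $(i\not\leadsto\alpha)\in\Phi$. Skolem variables: for second-order variables $\beta$ of $\Phi$, let $\mathrm{SV}'(\beta)$ be the least sets of index variables such that for every $(\mathfrak a\le\mathfrak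 b)\in\Phi$ with $\beta$ occurring in $\mathfrak b$: $\mathrm{Var}(\mathfrak a)\subseteq\mathrm{SV}'(\beta)$, and $\mathrm{SV}'(\alpha)\subseteq\mathrm{SV}'(\beta)$ for each second-order variable $\alpha$ occurring in $\mathfrak a$. Then $\mathrm{SV}(\beta)=\mathrm{SV}'(\beta)\setminus\{i\mid(i\not\leadsto\beta)\in\Phi\}$. -}

module Defs where

open import Data.Bool using (Bool; true; false)
open import Data.Nat using (ℕ; zero; suc; _+_; _≤_)
open import Data.Vec using (Vec; []; _∷_)
open import Data.Vec.Relation.Unary.Any using (Any)
open import Data.Vec.Relation.Binary.Pointwise.Inductive using (Pointwise)
open import Data.List using (List)
open import Data.List.Membership.Propositional using (_∈_)
open import Data.Product using (_×_)
open import Relation.Nullary using (¬_)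

-- Index variables i and second-order index variables α are both drawn
-- from ℕ (countably infinite sets).

-- Index symbols.  F k is the set of additional (user) k-ary symbols;
-- the symbols 0, s, + are always present.

data Sym (F : ℕ → Set) : ℕ → Set where
  zeroS : Sym F 0
  sucS  : Sym F 1
  plusS : Sym F 2
  user  : ∀ {k} → F k → Sym F k

-- Index terms.  Term F true  = second-order index terms (may contain α);
--               Term F false = (first-order) index terms.

data Term (F : ℕ → Set) : Bool → Set where
  var  : ∀ {b} → ℕ → Term F b
  svar : ℕ → Term F true
  app  : ∀ {b k} → Sym F k → Vec (Term F b) k → Term F b

data _∈Var_ {F : ℕ → Set} {b : Bool} (i : ℕ) : Term F b → Set where
  here : i ∈Var var i
  arg  : ∀ {k} {g : Sym F k} {ts : Vec (Term F b) k} →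
         Any (i ∈Var_) ts → i ∈Var app g ts

data _∈SO_ {F : ℕ → Set} (α : ℕ) : Term F true → Set where
  here : α ∈SO svar α
  arg  : ∀ {k} {g : Sym F k} {ts : Vec (Term F true) k} →
         Any (α ∈SO_) ts → α ∈SO app g ts

SOSubst : (F : ℕ → Set) → Set
SOSubst F = ℕ → Term F false

mutual
  _⟨_⟩ : ∀ {F} → Term F true → SOSubst F → Term F false
  var i    ⟨ κ ⟩ = var i
  svar α   ⟨ κ ⟩ = κ α
  app g ts ⟨ κ ⟩ = app g (substVec ts κ)

  substVec : ∀ {F k} → Vec (Term F true) k → SOSubst F → Vec (Term F false) k
  substVec []       κ = []
  substVec (t ∷ ts) κ = (t ⟨ κ ⟩) ∷ substVec ts κ

record Interp (F : ℕ → Set) : Set where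
  field
    fun  : ∀ {k} → F k → Vec ℕ k → ℕ
    mono : ∀ {k} (f : F k) {xs ys : Vec ℕ k} →
           Pointwise _≤_ xs ys → fun f xs ≤ fun f ys

⟦_⟧Sym : ∀ {F k} → Sym F k → Interp F → Vec ℕ k → ℕ
⟦ zeroS  ⟧Sym J []           = 0
⟦ sucS   ⟧Sym J (x ∷ [])     = suc x
⟦ plusS  ⟧Sym J (x ∷ y ∷ []) = x + y
⟦ user f ⟧Sym J xs           = Interp.fun J f xs

mutual
  ⟦_⟧ : ∀ {F} → Term F false → Interp F → (ℕ → ℕ) → ℕ
  ⟦ var i    ⟧ J ρ = ρ i
  ⟦ app g ts ⟧ J ρ = ⟦ g ⟧Sym J (⟦ ts ⟧Vec J ρ)

  ⟦_⟧Vec : ∀ {F k} → Vec (Term F false) k → Interp F → (ℕ → ℕ) → Vec ℕ k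
  ⟦ []     ⟧Vec J ρ = []
  ⟦ t ∷ ts ⟧Vec J ρ = ⟦ t ⟧ J ρ ∷ ⟦ ts ⟧Vec J ρ

_≤[_]_ : ∀ {F} → Term F false → Interp F → Term F false → Set
a ≤[ J ] b = ∀ (ρ : ℕ → ℕ) → ⟦ a ⟧ J ρ ≤ ⟦ b ⟧ J ρ

data Constraint (F : ℕ → Set) : Set where
  _≤c_  : Term F true → Term F true → Constraint F
  _↛c_  : ℕ → ℕ → Constraint F

SOCP : (F : ℕ → Set) → Set
SOCP F = List (Constraint F)

record IsModel {F : ℕ → Set} (Φ : SOCP F) (J : Interp F) (κ : SOSubst F) : Set where
  field
    ineq : ∀ {a b} → (a ≤c b) ∈ Φ → (a ⟨ κ ⟩) ≤[ J ] (b ⟨ κ ⟩)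
    occ  : ∀ {i α} → (i ↛c α) ∈ Φ → ¬ (i ∈Var κ α)

data SOVarOf {F : ℕ → Set} (Φ : SOCP F) (α : ℕ) : Set where
  inLeft  : ∀ {a b} → (a ≤c b) ∈ Φ → α ∈SO a → SOVarOf Φ α
  inRight : ∀ {a b} → (a ≤c b) ∈ Φ → α ∈SO b → SOVarOf Φ α
  inOcc   : ∀ {i} → (i ↛c α) ∈ Φ → SOVarOf Φ α

data SV' {F : ℕ → Set} (Φ : SOCP F) : ℕ → ℕ → Set where
  fromVar : ∀ {a b β i} → (a ≤c b) ∈ Φ → β ∈SO b → i ∈Var a → SV' Φ β i
  fromSO  : ∀ {a b α β i} → (a ≤c b) ∈ Φ → β ∈SO b → α ∈SO a →
            SV' Φ α i → SV' Φ β i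

SV : ∀ {F : ℕ → Set} → SOCP F → ℕ → ℕ → Set
SV Φ β i = SV' Φ β i × ¬ ((i ↛c β) ∈ Φ)

module Submission where

-- Given a model (J, κ) of Φ, let κr(α) be κ(α) with every index
-- variable outside SV(α) replaced by 0.  Occurrence constraints i ̸⇝ α hold
-- for κr because such i are excluded from SV(α).  For an inequality
-- 𝔞 ≤ 𝔟 and an assignment ρ, let ρ' agree with ρ on the "support" of 𝔞
-- (its own variables together with SV'(α) for each α in 𝔞) and be 0
-- elsewhere.  By monotonicity of evaluation,
--     ⟦𝔞κr⟧ρ ≤ ⟦𝔞κ⟧ρ' ≤ ⟦𝔟κ⟧ρ' ≤ ⟦𝔟κr⟧ρ,
-- the middle step being the hypothesis that κ is a model; the last step
-- uses that the support of 𝔞 lies in SV'(β) for each β in 𝔟.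

open import Defs
open import Data.Bool using (true; false)
open import Data.Nat using (ℕ; zero; suc; _≤_; z≤n; s≤s; _≟_)
open import Data.Nat.Properties using (≤-refl; ≤-reflexive; ≤-trans; +-mono-≤; suc-injective)
open import Data.Product using (Σ; _×_; _,_; proj₁; proj₂)
open import Data.Sum using (_⊎_; inj₁; inj₂)
open import Data.Empty using (⊥; ⊥-elim)
open import Data.List using (List; []; _∷_; length)
open import Data.List.Properties using (length-removeAt′)
open import Data.List.Membership.Propositional using (_∈_)
open import Data.List.Relation.Binary.Subset.Propositional using (_⊆_)
open import Data.List.Relation.Unary.Any as ListAny using (_─_; any?)
open import Data.Vec using (Vec; []; _∷_)
open import Data.Vec.Relation.Unary.Any using (Any; here; there)
open import Data.Vec.Relation.Binary.Pointwise.Inductive using (Pointwise; []; _∷_)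
open import Relation.Nullary using (Dec; yes; no)
open import Relation.Nullary.Decidable using (_×-dec_; _⊎-dec_; ¬?; map′)
open import Relation.Binary.PropositionalEquality using (_≡_; refl; sym; trans; cong; cong₂)

module _ {A : Set} where

  length-─ : ∀ {x : A} {xs} (p : x ∈ xs) → suc (length (xs ─ p)) ≡ length xs
  length-─ {xs = xs} p = sym (length-removeAt′ xs (ListAny.index p))

  ─-⊆ : ∀ {x : A} {xs} (p : x ∈ xs) → (xs ─ p) ⊆ xs
  ─-⊆ (ListAny.here _)  q                  = ListAny.there q
  ─-⊆ (ListAny.there p) (ListAny.here e)  = ListAny.here e
  ─-⊆ (ListAny.there p) (ListAny.there q) = ListAny.there (─-⊆ p q)

  ─-split : ∀ {x y : A} {xs} (p : x ∈ xs) → y ∈ xs → y ≡ x ⊎ y ∈ (xs ─ p)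
  ─-split (ListAny.here refl) (ListAny.here refl) = inj₁ refl
  ─-split (ListAny.here _)    (ListAny.there q)   = inj₂ q
  ─-split (ListAny.there p)   (ListAny.here e)    = inj₂ (ListAny.here e)
  ─-split (ListAny.there p)   (ListAny.there q)   with ─-split p q
  ... | inj₁ e = inj₁ e
  ... | inj₂ r = inj₂ (ListAny.there r)

  -- existence of a member satisfying a decidable property of its membership
  -- proof is decidable (the property may mention xs ─ p, as used below)
  ∃∈-dec : ∀ (xs : List A) (P : (x : A) → x ∈ xs → Set) → (∀ x p → Dec (P x p)) →
           Dec (Σ A λ x → Σ (x ∈ xs) λ p → P x p)
  ∃∈-dec []       P P? = no λ { (_ , () , _) }
  ∃∈-dec (x ∷ xs) P P? with P? x (ListAny.here refl)
  ... | yes h = yes (x , ListAny.here refl , h)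
  ... | no ¬h with ∃∈-dec xs (λ y p → P y (ListAny.there p)) (λ y p → P? y (ListAny.there p))
  ...   | yes (y , p , h) = yes (y , ListAny.there p , h)
  ...   | no ¬t = no λ { (_ , ListAny.here refl , h) → ¬h h
                       ; (y , ListAny.there p , h) → ¬t (y , p , h) }

mask : {P : ℕ → Set} → (∀ i → Dec (P i)) → (ℕ → ℕ) → ℕ → ℕ
mask P? ρ i with P? i
... | yes _ = ρ i
... | no _  = 0

mask-≤ : ∀ {P : ℕ → Set} (P? : ∀ i → Dec (P i)) ρ i → mask P? ρ i ≤ ρ i
mask-≤ P? ρ i with P? i
... | yes _ = ≤-refl
... | no _  = z≤n

mask-keeps : ∀ {P : ℕ → Set} (P? : ∀ i → Dec (P i)) ρ {i} → P i → ρ i ≤ mask P? ρ i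
mask-keeps P? ρ {i} p with P? i
... | yes _ = ≤-refl
... | no ¬p = ⊥-elim (¬p p)

mask-mono : ∀ {P Q : ℕ → Set} (P? : ∀ i → Dec (P i)) (Q? : ∀ i → Dec (Q i)) ρ {i} →
            (P i → Q i) → mask P? ρ i ≤ mask Q? ρ i
mask-mono P? Q? ρ {i} P⇒Q with P? i | Q? i
... | yes _ | yes _ = ≤-refl
... | yes p | no ¬q = ⊥-elim (¬q (P⇒Q p))
... | no _  | _     = z≤n

module _ {F : ℕ → Set} where

  mutual
    ∈Var? : ∀ {b} (i : ℕ) (t : Term F b) → Dec (i ∈Var t)
    ∈Var? i (var j) with i ≟ j
    ... | yes refl = yes here
    ... | no i≢j   = no λ { here → i≢j refl }
    ∈Var? i (svar α)   = no λ ()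
    ∈Var? i (app g ts) = map′ arg (λ { (arg m) → m }) (∈VarVec? i ts)

    ∈VarVec? : ∀ {b k} (i : ℕ) (ts : Vec (Term F b) k) → Dec (Any (i ∈Var_) ts)
    ∈VarVec? i []       = no λ ()
    ∈VarVec? i (t ∷ ts) = map′ fromSum toSum (∈Var? i t ⊎-dec ∈VarVec? i ts)
      where
      fromSum : i ∈Var t ⊎ Any (i ∈Var_) ts → Any (i ∈Var_) (t ∷ ts)
      fromSum (inj₁ m) = here m
      fromSum (inj₂ m) = there m
      toSum : Any (i ∈Var_) (t ∷ ts) → i ∈Var t ⊎ Any (i ∈Var_) ts
      toSum (here m)  = inj₁ m
      toSum (there m) = inj₂ m

  ∃SO : Term F true → (ℕ → Set) → Set
  ∃SO a P = Σ ℕ λ α → α ∈SO a × P α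

  mutual
    ∃SO? : (a : Term F true) {P : ℕ → Set} → (∀ α → Dec (P α)) → Dec (∃SO a P)
    ∃SO? (var i)    P? = no λ { (_ , () , _) }
    ∃SO? (svar α)   P? = map′ (λ p → α , here , p) (λ { (_ , here , p) → p }) (P? α)
    ∃SO? (app g ts) P? =
      map′ (λ { (α , m , p) → α , arg m , p }) (λ { (α , arg m , p) → α , m , p })
           (∃SOVec? ts P?)

    ∃SOVec? : ∀ {k} (ts : Vec (Term F true) k) {P : ℕ → Set} → (∀ α → Dec (P α)) →
              Dec (Σ ℕ λ α → Any (α ∈SO_) ts × P α)
    ∃SOVec? []       P? = no λ { (_ , () , _) }
    ∃SOVec? (t ∷ ts) {P} P? = map′ fromSum toSum (∃SO? t P? ⊎-dec ∃SOVec? ts P?)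
      where
      fromSum : ∃SO t P ⊎ (Σ ℕ λ α → Any (α ∈SO_) ts × P α) →
                Σ ℕ λ α → Any (α ∈SO_) (t ∷ ts) × P α
      fromSum (inj₁ (α , m , p)) = α , here m , p
      fromSum (inj₂ (α , m , p)) = α , there m , p
      toSum : (Σ ℕ λ α → Any (α ∈SO_) (t ∷ ts) × P α) →
              ∃SO t P ⊎ (Σ ℕ λ α → Any (α ∈SO_) ts × P α)
      toSum (α , here m , p)  = inj₁ (α , m , p)
      toSum (α , there m , p) = inj₂ (α , m , p)

  ∈SO? : (α : ℕ) (a : Term F true) → Dec (α ∈SO a)
  ∈SO? α a = map′ (λ { (_ , m , refl) → m }) (λ m → α , m , refl) (∃SO? a (_≟ α))

  ↛∈? : (i β : ℕ) (Φ : SOCP F) → Dec ((i ↛c β) ∈ Φ)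
  ↛∈? i β = any? isOcc?
    where
    isOcc? : (c : Constraint F) → Dec ((i ↛c β) ≡ c)
    isOcc? (a ≤c b) = no λ ()
    isOcc? (j ↛c γ) = map′ (λ { (refl , refl) → refl }) (λ { refl → refl , refl })
                           (i ≟ j ×-dec β ≟ γ)

  -- Fires Ψ i a says that i lies in the support of a
  -- (Var(a) or SV'(α) for some α in a), so that any constraint a ≤ 𝔟 in Ψ
  -- puts i into SV'(β) for every β occurring in 𝔟.

  Fires : SOCP F → ℕ → Term F true → Set
  Fires Ψ i a = i ∈Var a ⊎ ∃SO a (λ α → SV' Ψ α i)

  SV'-mono : ∀ {Ψ Ψ' : SOCP F} {β i} → Ψ ⊆ Ψ' → SV' Ψ β i → SV' Ψ' β i
  SV'-mono Ψ⊆Ψ' (fromVar m βb v)   = fromVar (Ψ⊆Ψ' m) βb v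
  SV'-mono Ψ⊆Ψ' (fromSO m βb αa d) = fromSO (Ψ⊆Ψ' m) βb αa (SV'-mono Ψ⊆Ψ' d)

  isolate : ∀ {Ψ a b α i} (p : (a ≤c b) ∈ Ψ) →
            SV' Ψ α i → SV' (Ψ ─ p) α i ⊎ Fires (Ψ ─ p) i a
  isolate p (fromVar q βb v) with ─-split p q
  ... | inj₁ refl = inj₂ (inj₁ v)
  ... | inj₂ q'   = inj₁ (fromVar q' βb v)
  isolate p (fromSO q βb γa d) with isolate p d
  ... | inj₂ f  = inj₂ f
  ... | inj₁ d' with ─-split p q
  ...   | inj₁ refl = inj₂ (inj₂ (_ , γa , d'))
  ...   | inj₂ q'   = inj₁ (fromSO q' βb γa d')

  -- root step of a derivation whose subderivations avoid the root constraint
  RootStep : (Ψ : SOCP F) → ℕ → ℕ → (c : Constraint F) → c ∈ Ψ → Set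
  RootStep Ψ β i (a ≤c b) p = β ∈SO b × Fires (Ψ ─ p) i a
  RootStep Ψ β i (j ↛c γ) p = ⊥

  SV'⇒RootStep : ∀ {Ψ β i} →
    SV' Ψ β i → Σ (Constraint F) λ c → Σ (c ∈ Ψ) λ p → RootStep Ψ β i c p
  SV'⇒RootStep (fromVar p βb v) = _ , p , βb , inj₁ v
  SV'⇒RootStep (fromSO p βb αa d) with isolate p d
  ... | inj₁ d' = _ , p , βb , inj₂ (_ , αa , d')
  ... | inj₂ f  = _ , p , βb , f

  RootStep⇒SV' : ∀ {Ψ β i} →
    Σ (Constraint F) (λ c → Σ (c ∈ Ψ) λ p → RootStep Ψ β i c p) → SV' Ψ β i
  RootStep⇒SV' ((a ≤c b) , p , βb , inj₁ v)            = fromVar p βb v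
  RootStep⇒SV' ((a ≤c b) , p , βb , inj₂ (α , αa , d)) = fromSO p βb αa (SV'-mono (─-⊆ p) d)
  RootStep⇒SV' ((j ↛c γ) , p , ())

  -- by induction on the number of constraints: try each constraint as root,
  -- deciding the premises recursively without it
  SV'-dec : ∀ n (Ψ : SOCP F) → length Ψ ≡ n → ∀ β i → Dec (SV' Ψ β i)
  SV'-dec zero    []      refl β i = no λ { (fromVar () _ _) ; (fromSO () _ _ _) }
  SV'-dec (suc n) Ψ       len  β i =
    map′ RootStep⇒SV' SV'⇒RootStep (∃∈-dec Ψ (RootStep Ψ β i) RootStep?)
    where
    RootStep? : ∀ c p → Dec (RootStep Ψ β i c p)
    RootStep? (a ≤c b) p = ∈SO? β b ×-dec (∈Var? i a ⊎-dec ∃SO? a (λ α → SV'-dec n (Ψ ─ p)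
      (suc-injective (trans (length-─ p) len)) α i))
    RootStep? (j ↛c γ) p = no λ ()

  SV'? : (Φ : SOCP F) → ∀ β i → Dec (SV' Φ β i)
  SV'? Φ = SV'-dec (length Φ) Φ refl

  SV? : (Φ : SOCP F) → ∀ β i → Dec (SV Φ β i)
  SV? Φ β i = SV'? Φ β i ×-dec ¬? (↛∈? i β Φ)

  module _ {P : ℕ → Set} (P? : ∀ i → Dec (P i)) where

    mutual
      restrict : Term F false → Term F false
      restrict (var i) with P? i
      ... | yes _ = var i
      ... | no _  = app zeroS []
      restrict (app g ts) = app g (restrictVec ts)

      restrictVec : ∀ {k} → Vec (Term F false) k → Vec (Term F false) k
      restrictVec []       = []
      restrictVec (t ∷ ts) = restrict t ∷ restrictVec ts

    mutual
      restrict-vars : ∀ {i} t → i ∈Var restrict t → P i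
      restrict-vars (var j) m with P? j | m
      ... | yes p | here = p
      ... | no _  | arg ()
      restrict-vars (app g ts) (arg m) = restrictVec-vars ts m

      restrictVec-vars : ∀ {i k} (ts : Vec (Term F false) k) →
                         Any (i ∈Var_) (restrictVec ts) → P i
      restrictVec-vars (t ∷ ts) (here m)  = restrict-vars t m
      restrictVec-vars (t ∷ ts) (there m) = restrictVec-vars ts m

    mutual
      restrict-eval : ∀ J ρ t → ⟦ restrict t ⟧ J ρ ≡ ⟦ t ⟧ J (mask P? ρ)
      restrict-eval J ρ (var j) with P? j
      ... | yes _ = refl
      ... | no _  = refl
      restrict-eval J ρ (app g ts) = cong (⟦ g ⟧Sym J) (restrictVec-eval J ρ ts)

      restrictVec-eval : ∀ {k} J ρ (ts : Vec (Term F false) k) →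
                         ⟦ restrictVec ts ⟧Vec J ρ ≡ ⟦ ts ⟧Vec J (mask P? ρ)
      restrictVec-eval J ρ []       = refl
      restrictVec-eval J ρ (t ∷ ts) = cong₂ _∷_ (restrict-eval J ρ t) (restrictVec-eval J ρ ts)

  ⟦⟧Sym-mono : ∀ {k} (J : Interp F) (g : Sym F k) {xs ys : Vec ℕ k} →
               Pointwise _≤_ xs ys → ⟦ g ⟧Sym J xs ≤ ⟦ g ⟧Sym J ys
  ⟦⟧Sym-mono J zeroS    []           = z≤n
  ⟦⟧Sym-mono J sucS     (p ∷ [])     = s≤s p
  ⟦⟧Sym-mono J plusS    (p ∷ q ∷ []) = +-mono-≤ p q
  ⟦⟧Sym-mono J (user f) ps           = Interp.mono J f ps

  module _ (J : Interp F) where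

    mutual
      eval-mono : ∀ (t : Term F false) {ρ ρ'} → (∀ i → i ∈Var t → ρ i ≤ ρ' i) →
                  ⟦ t ⟧ J ρ ≤ ⟦ t ⟧ J ρ'
      eval-mono (var i)    ρ≤ρ' = ρ≤ρ' i here
      eval-mono (app g ts) ρ≤ρ' = ⟦⟧Sym-mono J g (evalVec-mono ts (λ i m → ρ≤ρ' i (arg m)))

      evalVec-mono : ∀ {k} (ts : Vec (Term F false) k) {ρ ρ'} →
                     (∀ i → Any (i ∈Var_) ts → ρ i ≤ ρ' i) →
                     Pointwise _≤_ (⟦ ts ⟧Vec J ρ) (⟦ ts ⟧Vec J ρ')
      evalVec-mono []       ρ≤ρ' = []
      evalVec-mono (t ∷ ts) ρ≤ρ' = eval-mono t (λ i m → ρ≤ρ' i (here m))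
                                 ∷ evalVec-mono ts (λ i m → ρ≤ρ' i (there m))

    mutual
      subst-eval-mono : ∀ (a : Term F true) {ρ ρ' κ κ'} →
        (∀ i → i ∈Var a → ρ i ≤ ρ' i) →
        (∀ α → α ∈SO a → ⟦ κ α ⟧ J ρ ≤ ⟦ κ' α ⟧ J ρ') →
        ⟦ a ⟨ κ ⟩ ⟧ J ρ ≤ ⟦ a ⟨ κ' ⟩ ⟧ J ρ'
      subst-eval-mono (var i)    ρ≤ρ' κ≤κ' = ρ≤ρ' i here
      subst-eval-mono (svar α)   ρ≤ρ' κ≤κ' = κ≤κ' α here
      subst-eval-mono (app g ts) ρ≤ρ' κ≤κ' = ⟦⟧Sym-mono J g
        (substVec-eval-mono ts (λ i m → ρ≤ρ' i (arg m)) (λ α m → κ≤κ' α (arg m)))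

      substVec-eval-mono : ∀ {k} (ts : Vec (Term F true) k) {ρ ρ' κ κ'} →
        (∀ i → Any (i ∈Var_) ts → ρ i ≤ ρ' i) →
        (∀ α → Any (α ∈SO_) ts → ⟦ κ α ⟧ J ρ ≤ ⟦ κ' α ⟧ J ρ') →
        Pointwise _≤_ (⟦ substVec ts κ ⟧Vec J ρ) (⟦ substVec ts κ' ⟧Vec J ρ')
      substVec-eval-mono []       ρ≤ρ' κ≤κ' = []
      substVec-eval-mono (t ∷ ts) ρ≤ρ' κ≤κ' =
          subst-eval-mono t (λ i m → ρ≤ρ' i (here m)) (λ α m → κ≤κ' α (here m))
        ∷ substVec-eval-mono ts (λ i m → ρ≤ρ' i (there m)) (λ α m → κ≤κ' α (there m))

  module _ (Φ : SOCP F) where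

    restrictToSV : SOSubst F → SOSubst F
    restrictToSV κ α = restrict (SV? Φ α) (κ α)

    support? : (a : Term F true) → ∀ i → Dec (Fires Φ i a)
    support? a i = ∈Var? i a ⊎-dec ∃SO? a (λ α → SV'? Φ α i)

  module _ (Φ : SOCP F) (J : Interp F) (κ : SOSubst F) where

    -- the variables of κr(α), for α in 𝔞, all lie in the support of 𝔞
    restrict-lhs : ∀ a ρ →
      ⟦ a ⟨ restrictToSV Φ κ ⟩ ⟧ J ρ ≤ ⟦ a ⟨ κ ⟩ ⟧ J (mask (support? Φ a) ρ)
    restrict-lhs a ρ = subst-eval-mono J a
      (λ i i∈a → mask-keeps (support? Φ a) ρ (inj₁ i∈a))
      (λ α α∈a → ≤-trans (≤-reflexive (restrict-eval (SV? Φ α) J ρ (κ α)))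
        (eval-mono J (κ α) (λ i _ →
          mask-mono (SV? Φ α) (support? Φ a) ρ (λ i∈SV → inj₂ (α , α∈a , proj₁ i∈SV)))))

    -- a constraint 𝔞 ≤ 𝔟 puts the support of 𝔞 into SV'(β) for each β in 𝔟;
    -- the occurrence constraints of the model keep κ(β) inside SV(β)
    restrict-rhs : IsModel Φ J κ → ∀ {a b} → (a ≤c b) ∈ Φ → ∀ ρ →
      ⟦ b ⟨ κ ⟩ ⟧ J (mask (support? Φ a) ρ) ≤ ⟦ b ⟨ restrictToSV Φ κ ⟩ ⟧ J ρ
    restrict-rhs M {a} {b} a≤b ρ = subst-eval-mono J b
      (λ i _ → mask-≤ (support? Φ a) ρ i)
      (λ β β∈b → ≤-trans
        (eval-mono J (κ β) (λ i i∈κβ → mask-mono (support? Φ a) (SV? Φ β) ρ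
          (λ i∈supp → fires⇒SV' a≤b β∈b i∈supp , λ i↛β → IsModel.occ M i↛β i∈κβ)))
        (≤-reflexive (sym (restrict-eval (SV? Φ β) J ρ (κ β)))))
      where
      fires⇒SV' : ∀ {β i} → (a ≤c b) ∈ Φ → β ∈SO b → Fires Φ i a → SV' Φ β i
      fires⇒SV' c β∈b (inj₁ i∈a)            = fromVar c β∈b i∈a
      fires⇒SV' c β∈b (inj₂ (α , α∈a , d)) = fromSO c β∈b α∈a d

lemma6p3 : {F : ℕ → Set} (Φ : SOCP F) (J : Interp F) (κ : SOSubst F) →
    IsModel Φ J κ →
    Σ (SOSubst F) (λ κr → IsModel Φ J κr ×
    (∀ α → SOVarOf Φ α → ∀ i → i ∈Var κr α → SV Φ α i))
lemma6p3 Φ J κ M = restrictToSV Φ κ , model , λ α _ i → varsInSV α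
  where
  varsInSV : ∀ α {i} → i ∈Var restrictToSV Φ κ α → SV Φ α i
  varsInSV α = restrict-vars (SV? Φ α) (κ α)

  model : IsModel Φ J (restrictToSV Φ κ)
  model = record
    { ineq = λ {a} a≤b ρ → ≤-trans (restrict-lhs Φ J κ a ρ)
               (≤-trans (IsModel.ineq M a≤b _) (restrict-rhs Φ J κ M a≤b ρ))
    ; occ  = λ {i} {α} i↛α i∈κrα → proj₂ (varsInSV α i∈κrα) i↛α
    }
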